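{- Let $m,n$ be positive integers and let $B_{mn}$ be the $m\times n$ grid of cells, where cell $(i,j)$ is in the $i$-th row from the top and $j$-th column from the left. Let $\mathcal{P}(B_{mn})$ be the set of lattice paths (unit steps up and right along grid lines) from the lower-left corner to the upper-right corner of $B_{mn}$, and let $f(i,j)$ be the number of paths in $\mathcal{P}(B_{mn})$ that lie below the cell $(i,j)$ (possibly touching the right or lower border of that cell). Then \[ \sum_{1\le i\le m,\ 1\le j\le n} i\, f(i,j) \;=\; \binom{m+2}{3}\binom{m+n}{m+1} \] and \[ \sum_{1\le i\le m,\ 1\le j\le n} j\, f(i,j) \;=\; \binom{n+2}{3}\binom{m+n}{n+1}. \] -}

module Defs where

open import Data.Nat using (ℕ; zero; suc; _+_; _*_; _∸_; _≤_; _≤?_)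
open import Data.Nat.Properties using (_≟_)
open import Data.List using (List; []; _∷_; _++_; map; length; filter)
open import Data.Product using (_×_)
open import Relation.Nullary.Decidable using (_×-dec_)
open import Relation.Binary.PropositionalEquality using (_≡_)

data Step : Set where
  U R : Step

words : ℕ → List (List Step)
words zero    = [] ∷ []
words (suc k) = map (U ∷_) (words k) ++ map (R ∷_) (words k)

ups : List Step → ℕ
ups []      = 0
ups (U ∷ w) = suc (ups w)
ups (R ∷ w) = ups w

-- Lattice paths in the m × n board (m rows, n columns) from the lower-left
-- corner (0,0) to the upper-right corner (n,m): words of length m + n with
-- exactly m up steps (hence exactly n right steps).
IsPath : ℕ → ℕ → List Step → Set
IsPath m n w = (length w ≡ m + n) × (ups w ≡ m)

-- Height (y-coordinate) at which the j-th right step (j ≥ 1) is taken,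
-- i.e. the step from x = j-1 to x = j.
rightHeight : ℕ → List Step → ℕ
rightHeight j       (U ∷ w) = suc (rightHeight j w)
rightHeight (suc zero)    (R ∷ w) = 0
rightHeight (suc (suc j)) (R ∷ w) = rightHeight (suc j) w
rightHeight zero    (R ∷ w) = 0
rightHeight j       []      = 0

-- Cell (i,j) (row i from the top, column j from the left, 1-based) of the
-- m × n board occupies [j-1, j] × [m-i, m-i+1].  A path lies below the cell
-- (possibly touching its lower or right border) iff its step across the
-- column x ∈ [j-1, j] is taken at height ≤ m - i.
Below : ℕ → ℕ → ℕ → List Step → Set
Below m i j w = rightHeight j w ≤ m ∸ i

f : ℕ → ℕ → ℕ → ℕ → ℕ
f m n i j = length (filter (λ w → ((length w ≟ m + n) ×-dec (ups w ≟ m)) ×-dec (rightHeight j w ≤? m ∸ i)) (words (m + n)))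

sum1 : ℕ → (ℕ → ℕ) → ℕ
sum1 zero    g = 0
sum1 (suc N) g = sum1 N g + g (suc N)

module Submission where

-- For a weight c(i,j) on the cells, let T_c(m,n) be the total, over all lattice
-- paths of the m × n board, of the weight of the cells lying above the path;
-- the two sums of the theorem are T_c(m,n) for c(i,j) = i and c(i,j) = j.
-- Splitting the paths by their first step (up or right) gives a Pascal-type
-- recurrence T(m+1,n+1) = T(m,n+1) + g(m,n) + T(m+1,n): an up step drops the
-- bottom row, a right step puts the whole first column above the path, so the
-- source g(m,n) is the weight of that column times the number of paths of
-- B_(m+1)n (plus, for c(i,j) = j, the unit weight coming from the column
-- shift), and T vanishes when m = 0 or n = 0.  Such a recurrence has at most
-- one solution vanishing on the axes, so it suffices to check that the claimed
-- closed forms satisfy it.  For weights depending only on the row, b(m) · C(m+n, m+1)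
-- solves it whenever b(m) = Σ_{k ≤ m} Σ_{i ≤ k} c(i); for c(i,j) = j the
-- recurrence becomes that of c(i,j) = i transposed, by a binomial identity.

open import Defs
open import Data.Nat using (ℕ; suc; _+_; _*_; _≤_)
open import Data.Nat.Combinatorics using (_C_)
open import Data.Product using (_×_)
open import Relation.Binary.PropositionalEquality using (_≡_)

open import Data.Bool using (Bool; true; false; _∧_)
open import Data.List using (List; []; _∷_; _++_; map; length; filter)
open import Data.List.Properties using (map-++; map-∘; map-cong)
open import Data.Nat using (zero; _∸_; _≤?_; z≤n; s≤s; s≤s⁻¹)
open import Data.Nat.Combinatorics using (nCk+nC[k+1]≡[n+1]C[k+1]; k>n⇒nCk≡0; nC1≡n; nCk≡nC[n∸k])
open import Data.Nat.ListAction using (sum)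
open import Data.Nat.ListAction.Properties using (sum-++)
open import Data.Nat.Properties
open import Algebra.Properties.CommutativeSemigroup +-commutativeSemigroup using (interchange)
open import Algebra.Properties.CommutativeSemigroup *-commutativeSemigroup using (x∙yz≈y∙xz)
open import Data.Nat.Tactic.RingSolver using (solve-∀)
open import Data.Product using (_,_; swap)
open import Function using (_∘_; flip; mk⇔)
open import Relation.Nullary.Decidable using (Dec; does; does-⇔; dec-true)
open import Relation.Binary.PropositionalEquality using (refl; sym; trans; cong; cong₂; module ≡-Reasoning)
open ≡-Reasoning

pascal : ∀ n k → n C k + n C suc k ≡ suc n C suc k
pascal = nCk+nC[k+1]≡[n+1]C[k+1]

𝟙 : Bool → ℕ
𝟙 true  = 1
𝟙 false = 0

𝟙-∧ : ∀ a b → 𝟙 (a ∧ b) ≡ 𝟙 a * 𝟙 b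
𝟙-∧ true  b = sym (+-identityʳ (𝟙 b))
𝟙-∧ false b = refl

length-filter : ∀ {A : Set} {P : A → Set} (P? : ∀ x → Dec (P x)) (xs : List A) →
  length (filter P? xs) ≡ sum (map (𝟙 ∘ does ∘ P?) xs)
length-filter P? [] = refl
length-filter P? (x ∷ xs) with does (P? x)
... | true  = cong suc (length-filter P? xs)
... | false = length-filter P? xs

sum-map-+ : ∀ {A : Set} (g h : A → ℕ) (xs : List A) →
  sum (map (λ x → g x + h x) xs) ≡ sum (map g xs) + sum (map h xs)
sum-map-+ g h [] = refl
sum-map-+ g h (x ∷ xs) = trans (cong (g x + h x +_) (sum-map-+ g h xs)) (interchange (g x) (h x) _ _)

sum-map-* : ∀ {A : Set} (c : ℕ) (g : A → ℕ) (xs : List A) →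
  sum (map (λ x → c * g x) xs) ≡ c * sum (map g xs)
sum-map-* c g [] = sym (*-zeroʳ c)
sum-map-* c g (x ∷ xs) = trans (cong (c * g x +_) (sum-map-* c g xs)) (sym (*-distribˡ-+ c (g x) _))

sum-map-0 : ∀ {A : Set} (xs : List A) → sum (map (λ _ → 0) xs) ≡ 0
sum-map-0 [] = refl
sum-map-0 (x ∷ xs) = sum-map-0 xs

sum1-cong≤ : ∀ N {g h : ℕ → ℕ} → (∀ i → 1 ≤ i → i ≤ N → g i ≡ h i) → sum1 N g ≡ sum1 N h
sum1-cong≤ zero    e = refl
sum1-cong≤ (suc N) e = cong₂ _+_ (sum1-cong≤ N (λ i 1≤i i≤N → e i 1≤i (m≤n⇒m≤1+n i≤N)))
                                 (e (suc N) (s≤s z≤n) ≤-refl)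

sum1-cong : ∀ N {g h : ℕ → ℕ} → (∀ i → g i ≡ h i) → sum1 N g ≡ sum1 N h
sum1-cong N e = sum1-cong≤ N (λ i _ _ → e i)

sum1-+ : ∀ N (g h : ℕ → ℕ) → sum1 N (λ i → g i + h i) ≡ sum1 N g + sum1 N h
sum1-+ zero    g h = refl
sum1-+ (suc N) g h = trans (cong (_+ (g (suc N) + h (suc N))) (sum1-+ N g h))
                           (interchange (sum1 N g) (sum1 N h) (g (suc N)) (h (suc N)))

sum1-* : ∀ N c (g : ℕ → ℕ) → sum1 N (λ i → c * g i) ≡ c * sum1 N g
sum1-* zero    c g = sym (*-zeroʳ c)
sum1-* (suc N) c g = trans (cong (_+ c * g (suc N)) (sum1-* N c g)) (sym (*-distribˡ-+ c _ _))

sum1-0 : ∀ N → sum1 N (λ _ → 0) ≡ 0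
sum1-0 zero    = refl
sum1-0 (suc N) = trans (+-identityʳ _) (sum1-0 N)

sum1-first : ∀ N (g : ℕ → ℕ) → sum1 (suc N) g ≡ g 1 + sum1 N (g ∘ suc)
sum1-first zero    g = +-comm 0 (g 1)
sum1-first (suc N) g = trans (cong (_+ g (suc (suc N))) (sum1-first N g)) (+-assoc (g 1) _ _)

sum1-1 : ∀ N → sum1 N (λ _ → 1) ≡ N
sum1-1 zero    = refl
sum1-1 (suc N) = trans (cong (_+ 1) (sum1-1 N)) (+-comm N 1)

triangular : ∀ N → sum1 N (λ i → i) ≡ suc N C 2
triangular zero    = refl
triangular (suc N) = begin
  sum1 N (λ i → i) + suc N    ≡⟨ cong₂ _+_ (triangular N) (sym (nC1≡n (suc N))) ⟩
  suc N C 2 + suc N C 1       ≡⟨ +-comm (suc N C 2) _ ⟩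
  suc N C 1 + suc N C 2       ≡⟨ pascal (suc N) 1 ⟩
  suc (suc N) C 2             ∎

-- Sums over words and over lattice paths

ΣW : ℕ → (List Step → ℕ) → ℕ
ΣW k g = sum (map g (words k))

ΣW-suc : ∀ k g → ΣW (suc k) g ≡ ΣW k (g ∘ (U ∷_)) + ΣW k (g ∘ (R ∷_))
ΣW-suc k g = begin
  sum (map g (map (U ∷_) ws ++ map (R ∷_) ws))
    ≡⟨ cong sum (map-++ g (map (U ∷_) ws) _) ⟩
  sum (map g (map (U ∷_) ws) ++ map g (map (R ∷_) ws))
    ≡⟨ sum-++ (map g (map (U ∷_) ws)) _ ⟩
  sum (map g (map (U ∷_) ws)) + sum (map g (map (R ∷_) ws))
    ≡⟨ cong₂ _+_ (cong sum (sym (map-∘ ws))) (cong sum (sym (map-∘ ws))) ⟩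
  ΣW k (g ∘ (U ∷_)) + ΣW k (g ∘ (R ∷_)) ∎
  where
  ws = words k

ΣW-cong : ∀ k {g h : List Step → ℕ} → (∀ w → g w ≡ h w) → ΣW k g ≡ ΣW k h
ΣW-cong k e = cong sum (map-cong e (words k))

ΣW-cong-length : ∀ k {g h : List Step → ℕ} → (∀ w → length w ≡ k → g w ≡ h w) → ΣW k g ≡ ΣW k h
ΣW-cong-length zero    e = cong (_+ 0) (e [] refl)
ΣW-cong-length (suc k) {g} {h} e = begin
  ΣW (suc k) g                          ≡⟨ ΣW-suc k g ⟩
  ΣW k (g ∘ (U ∷_)) + ΣW k (g ∘ (R ∷_))
    ≡⟨ cong₂ _+_ (ΣW-cong-length k (λ w ∣w∣ → e (U ∷ w) (cong suc ∣w∣)))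
                 (ΣW-cong-length k (λ w ∣w∣ → e (R ∷ w) (cong suc ∣w∣))) ⟩
  ΣW k (h ∘ (U ∷_)) + ΣW k (h ∘ (R ∷_)) ≡⟨ ΣW-suc k h ⟨
  ΣW (suc k) h                          ∎

hasUps : ℕ → List Step → ℕ
hasUps m w = 𝟙 (does (ups w ≟ m))

count-ups : ∀ k m → ΣW k (hasUps m) ≡ k C m
count-ups zero    zero    = refl
count-ups zero    (suc m) = refl
count-ups (suc k) zero    = begin
  ΣW (suc k) (hasUps 0)            ≡⟨ ΣW-suc k (hasUps 0) ⟩
  ΣW k (λ _ → 0) + ΣW k (hasUps 0) ≡⟨ cong₂ _+_ (sum-map-0 (words k)) (count-ups k 0) ⟩
  1                                ∎
count-ups (suc k) (suc m) = begin
  ΣW (suc k) (hasUps (suc m))           ≡⟨ ΣW-suc k (hasUps (suc m)) ⟩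
  ΣW k (hasUps m) + ΣW k (hasUps (suc m)) ≡⟨ cong₂ _+_ (count-ups k m) (count-ups k (suc m)) ⟩
  k C m + k C suc m                     ≡⟨ pascal k m ⟩
  suc k C suc m                         ∎

ΣP : ℕ → ℕ → (List Step → ℕ) → ℕ
ΣP m n h = ΣW (m + n) (λ w → hasUps m w * h w)

ΣP-first-step : ∀ m n h →
  ΣP (suc m) (suc n) h ≡ ΣP m (suc n) (h ∘ (U ∷_)) + ΣP (suc m) n (h ∘ (R ∷_))
ΣP-first-step m n h =
  trans (ΣW-suc (m + suc n) _)
        (cong (λ k → ΣP m (suc n) (h ∘ (U ∷_)) + ΣW k (λ w → hasUps (suc m) w * h (R ∷ w))) (+-suc m n))

ΣP-cong : ∀ m n {h h' : List Step → ℕ} → (∀ w → h w ≡ h' w) → ΣP m n h ≡ ΣP m n h'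
ΣP-cong m n e = ΣW-cong (m + n) (λ w → cong (hasUps m w *_) (e w))

ΣP-0 : ∀ m n {h : List Step → ℕ} → (∀ w → h w ≡ 0) → ΣP m n h ≡ 0
ΣP-0 m n e = trans (ΣW-cong (m + n) (λ w → trans (cong (hasUps m w *_) (e w)) (*-zeroʳ (hasUps m w))))
                   (sum-map-0 (words (m + n)))

ΣP-+ : ∀ m n (h h' : List Step → ℕ) → ΣP m n (λ w → h w + h' w) ≡ ΣP m n h + ΣP m n h'
ΣP-+ m n h h' = trans (ΣW-cong (m + n) (λ w → *-distribˡ-+ (hasUps m w) (h w) (h' w)))
                      (sum-map-+ _ _ (words (m + n)))

ΣP-* : ∀ m n c (h : List Step → ℕ) → ΣP m n (λ w → c * h w) ≡ c * ΣP m n h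
ΣP-* m n c h = trans (ΣW-cong (m + n) (λ w → x∙yz≈y∙xz (hasUps m w) c (h w)))
                     (sum-map-* c _ (words (m + n)))

ΣP-sum1 : ∀ m n N (g : ℕ → List Step → ℕ) →
  sum1 N (λ i → ΣP m n (g i)) ≡ ΣP m n (λ w → sum1 N (λ i → g i w))
ΣP-sum1 m n zero    g = sym (ΣP-0 m n (λ _ → refl))
ΣP-sum1 m n (suc N) g =
  trans (cong (_+ ΣP m n (g (suc N))) (ΣP-sum1 m n N g)) (sym (ΣP-+ m n _ (g (suc N))))

ΣP-const : ∀ m n c → ΣP m n (λ _ → c) ≡ c * ((m + n) C m)
ΣP-const m n c = begin
  ΣP m n (λ _ → c)           ≡⟨ ΣP-cong m n (λ _ → sym (*-identityʳ c)) ⟩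
  ΣP m n (λ _ → c * 1)       ≡⟨ ΣP-* m n c (λ _ → 1) ⟩
  c * ΣW (m + n) (λ w → hasUps m w * 1)
    ≡⟨ cong (c *_) (trans (ΣW-cong (m + n) (λ w → *-identityʳ (hasUps m w))) (count-ups (m + n) m)) ⟩
  c * ((m + n) C m)          ∎

-- The weight of the cells above a path

below : ℕ → ℕ → ℕ → List Step → ℕ
below m i j w = 𝟙 (does (rightHeight j w ≤? m ∸ i))

weightAbove : (ℕ → ℕ → ℕ) → ℕ → ℕ → List Step → ℕ
weightAbove c m n w = sum1 m (λ i → sum1 n (λ j → c i j * below m i j w))

-- After an initial up step the rest of the path lies in the board without the
-- bottom row m+1, whose cells all lie below the path.
below-U : ∀ m i j w → i ≤ m → below (suc m) i j (U ∷ w) ≡ below m i j w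
below-U m i j w i≤m = begin
  𝟙 (does (suc h ≤? suc m ∸ i))   ≡⟨ cong (λ t → 𝟙 (does (suc h ≤? t))) (+-∸-assoc 1 i≤m) ⟩
  𝟙 (does (suc h ≤? suc (m ∸ i))) ≡⟨ cong 𝟙 (does-⇔ (mk⇔ s≤s⁻¹ s≤s) (suc h ≤? suc (m ∸ i)) (h ≤? m ∸ i)) ⟩
  𝟙 (does (h ≤? m ∸ i))           ∎
  where
  h = rightHeight j w

below-U-bottom : ∀ m j w → below (suc m) (suc m) j (U ∷ w) ≡ 0
below-U-bottom m j w rewrite n∸n≡0 m = refl

weightAbove-U : ∀ c m n w → weightAbove c (suc m) n (U ∷ w) ≡ weightAbove c m n w
weightAbove-U c m n w = begin
  weightAbove c (suc m) n (U ∷ w)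
    ≡⟨ cong₂ _+_ (sum1-cong≤ m (λ i _ i≤m → sum1-cong n (λ j → cong (c i j *_) (below-U m i j w i≤m))))
                 (sum1-cong n (λ j → trans (cong (c (suc m) j *_) (below-U-bottom m j w))
                                           (*-zeroʳ (c (suc m) j)))) ⟩
  weightAbove c m n w + sum1 n (λ _ → 0) ≡⟨ cong (weightAbove c m n w +_) (sum1-0 n) ⟩
  weightAbove c m n w + 0                ≡⟨ +-identityʳ _ ⟩
  weightAbove c m n w                    ∎

-- After an initial right step, the whole first column lies above the path and
-- the remaining columns are seen one column further left.
weightAbove-R : ∀ c m n w →
  weightAbove c m (suc n) (R ∷ w) ≡ sum1 m (λ i → c i 1) + weightAbove (λ i j → c i (suc j)) m n w
weightAbove-R c m n w = begin
  weightAbove c m (suc n) (R ∷ w)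
    ≡⟨ sum1-cong m (λ i → sum1-first n (λ j → c i j * below m i j (R ∷ w))) ⟩
  sum1 m (λ i → c i 1 * 1 + sum1 n (λ j → c i (suc j) * below m i (suc j) (R ∷ w)))
    ≡⟨ sum1-cong m (λ i → cong₂ _+_ (*-identityʳ (c i 1)) (sum1-cong≤ n (λ { (suc j) _ _ → refl }))) ⟩
  sum1 m (λ i → c i 1 + sum1 n (λ j → c i (suc j) * below m i j w))
    ≡⟨ sum1-+ m _ _ ⟩
  sum1 m (λ i → c i 1) + weightAbove (λ i j → c i (suc j)) m n w ∎

weightAbove-+ : ∀ c d m n w →
  weightAbove (λ i j → c i j + d i j) m n w ≡ weightAbove c m n w + weightAbove d m n w
weightAbove-+ c d m n w =
  trans (sum1-cong m (λ i → trans (sum1-cong n (λ j → *-distribʳ-+ (below m i j w) (c i j) (d i j)))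
                                  (sum1-+ n _ _)))
        (sum1-+ m _ _)

totalWeight : (ℕ → ℕ → ℕ) → ℕ → ℕ → ℕ
totalWeight c m n = ΣP m n (weightAbove c m n)

f-as-ΣP : ∀ m n i j → f m n i j ≡ ΣP m n (below m i j)
f-as-ΣP m n i j = trans (length-filter _ (words (m + n))) (ΣW-cong-length (m + n) onPaths)
  where
  onPaths : ∀ w → length w ≡ m + n →
    𝟙 ((does (length w ≟ m + n) ∧ does (ups w ≟ m)) ∧ does (rightHeight j w ≤? m ∸ i))
      ≡ hasUps m w * below m i j w
  onPaths w ∣w∣ rewrite dec-true (length w ≟ m + n) ∣w∣ = 𝟙-∧ (does (ups w ≟ m)) _

weighted-f-sum : ∀ c m n → sum1 m (λ i → sum1 n (λ j → c i j * f m n i j)) ≡ totalWeight c m n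
weighted-f-sum c m n = begin
  sum1 m (λ i → sum1 n (λ j → c i j * f m n i j))
    ≡⟨ sum1-cong m (λ i → sum1-cong n (λ j →
         trans (cong (c i j *_) (f-as-ΣP m n i j)) (sym (ΣP-* m n (c i j) (below m i j))))) ⟩
  sum1 m (λ i → sum1 n (λ j → ΣP m n (λ w → c i j * below m i j w)))
    ≡⟨ sum1-cong m (λ i → ΣP-sum1 m n n _) ⟩
  sum1 m (λ i → ΣP m n (λ w → sum1 n (λ j → c i j * below m i j w)))
    ≡⟨ ΣP-sum1 m n m _ ⟩
  totalWeight c m n ∎

totalWeight-+ : ∀ c d m n → totalWeight (λ i j → c i j + d i j) m n ≡ totalWeight c m n + totalWeight d m n
totalWeight-+ c d m n = trans (ΣP-cong m n (weightAbove-+ c d m n)) (ΣP-+ m n _ _)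

totalWeight-rec : ∀ c m n →
  totalWeight c (suc m) (suc n)
    ≡ totalWeight c m (suc n) + sum1 (suc m) (λ i → c i 1) * (suc (m + n) C suc m)
      + totalWeight (λ i j → c i (suc j)) (suc m) n
totalWeight-rec c m n = begin
  totalWeight c (suc m) (suc n)
    ≡⟨ ΣP-first-step m n _ ⟩
  ΣP m (suc n) (weightAbove c (suc m) (suc n) ∘ (U ∷_))
    + ΣP (suc m) n (weightAbove c (suc m) (suc n) ∘ (R ∷_))
    ≡⟨ cong₂ _+_ (ΣP-cong m (suc n) (weightAbove-U c m (suc n)))
                 (ΣP-cong (suc m) n (weightAbove-R c (suc m) n)) ⟩
  totalWeight c m (suc n) + ΣP (suc m) n (λ w → column1 + weightAbove c' (suc m) n w)
    ≡⟨ cong (totalWeight c m (suc n) +_)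
            (trans (ΣP-+ (suc m) n _ _) (cong (_+ totalWeight c' (suc m) n) (ΣP-const (suc m) n column1))) ⟩
  totalWeight c m (suc n) + (column1 * (suc (m + n) C suc m) + totalWeight c' (suc m) n)
    ≡⟨ +-assoc (totalWeight c m (suc n)) _ _ ⟨
  totalWeight c m (suc n) + column1 * (suc (m + n) C suc m) + totalWeight c' (suc m) n ∎
  where
  column1 = sum1 (suc m) (λ i → c i 1)
  c' = λ i j → c i (suc j)

-- Pascal recurrences

Pascal : (ℕ → ℕ → ℕ) → (ℕ → ℕ → ℕ) → Set
Pascal g T = ∀ m n → T (suc m) (suc n) ≡ T m (suc n) + g m n + T (suc m) n

VanishesOnAxes : (ℕ → ℕ → ℕ) → Set
VanishesOnAxes T = (∀ n → T 0 n ≡ 0) × (∀ m → T m 0 ≡ 0)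

pascal-unique : ∀ {g T F} → Pascal g T → Pascal g F → VanishesOnAxes T → VanishesOnAxes F →
  ∀ m n → T m n ≡ F m n
pascal-unique {g} {T} {F} pT pF (T0n , Tm0) (F0n , Fm0) = agree
  where
  agree : ∀ m n → T m n ≡ F m n
  agree zero    n       = trans (T0n n) (sym (F0n n))
  agree (suc m) zero    = trans (Tm0 (suc m)) (sym (Fm0 (suc m)))
  agree (suc m) (suc n) = begin
    T (suc m) (suc n)                   ≡⟨ pT m n ⟩
    T m (suc n) + g m n + T (suc m) n   ≡⟨ cong₂ (λ a b → a + g m n + b) (agree m (suc n)) (agree (suc m) n) ⟩
    F m (suc n) + g m n + F (suc m) n   ≡⟨ pF m n ⟨
    F (suc m) (suc n)                   ∎

pascal-source : ∀ {g g' T} → (∀ m n → g m n ≡ g' m n) → Pascal g T → Pascal g' T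
pascal-source {T = T} e p m n = trans (p m n) (cong (λ s → T m (suc n) + s + T (suc m) n) (e m n))

pascal-flip : ∀ {g T} → Pascal g T → Pascal (flip g) (flip T)
pascal-flip {g} {T} p m n = trans (p n m) (outer-swap (T n (suc m)) (g n m) (T (suc n) m))
  where
  outer-swap : ∀ a s b → a + s + b ≡ b + s + a
  outer-swap = solve-∀

totalWeight-vanishes : ∀ c → VanishesOnAxes (totalWeight c)
totalWeight-vanishes c = (λ n → ΣP-0 0 n (λ _ → refl)) , (λ m → ΣP-0 m 0 (λ _ → sum1-0 m))

-- Binomial identities

absorb : ∀ N k → suc k * (suc N C suc k) ≡ suc N * (N C k)
absorb zero    zero    = refl
absorb zero    (suc k) = *-zeroʳ (suc (suc k))
absorb (suc N) zero    = trans (*-identityˡ _) (trans (nC1≡n (suc (suc N))) (sym (*-identityʳ (suc (suc N)))))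
absorb (suc N) (suc k) = begin
  suc (suc k) * (suc (suc N) C suc (suc k))    ≡⟨ cong (suc (suc k) *_) (pascal (suc N) (suc k)) ⟨
  suc (suc k) * (p + s)                        ≡⟨ expand (suc k) p s ⟩
  p + suc k * p + suc (suc k) * s              ≡⟨ cong₂ (λ a b → p + a + b) (absorb N k) (absorb N (suc k)) ⟩
  p + suc N * P + suc N * Q                    ≡⟨ cong (λ t → t + suc N * P + suc N * Q) (sym (pascal N k)) ⟩
  P + Q + suc N * P + suc N * Q                ≡⟨ collect (suc N) P Q ⟩
  suc (suc N) * (P + Q)                        ≡⟨ cong (suc (suc N) *_) (pascal N k) ⟩
  suc (suc N) * (suc N C suc k)                ∎
  where
  P = N C k
  Q = N C suc k
  p = suc N C suc k
  s = suc N C suc (suc k)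
  expand : ∀ k p s → suc k * (p + s) ≡ p + k * p + suc k * s
  expand = solve-∀
  collect : ∀ N P Q → P + Q + N * P + N * Q ≡ suc N * (P + Q)
  collect = solve-∀

double-C2 : ∀ k → 2 * (suc (suc k) C 2) ≡ suc (suc k) * suc k
double-C2 k = trans (absorb (suc k) 1) (cong (suc (suc k) *_) (nC1≡n (suc k)))

C-symmetric : ∀ a b → (a + b) C b ≡ (a + b) C a
C-symmetric a b = sym (trans (nCk≡nC[n∸k] (m≤m+n a b)) (cong ((a + b) C_) (m+n∸m≡n a b)))

C-above : ∀ n → n C suc n ≡ 0
C-above n = k>n⇒nCk≡0 (n<1+n n)

consecutive : ∀ m n → n * ((m + n) C m) ≡ suc m * ((m + n) C suc m)
consecutive m n = sym (+-cancelˡ-≡ (suc m * u) _ _ (begin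
  suc m * u + suc m * v      ≡⟨ *-distribˡ-+ (suc m) u v ⟨
  suc m * (u + v)            ≡⟨ cong (suc m *_) (pascal (m + n) m) ⟩
  suc m * (suc (m + n) C suc m) ≡⟨ absorb (m + n) m ⟩
  (suc m + n) * u            ≡⟨ *-distribʳ-+ u (suc m) n ⟩
  suc m * u + n * u          ∎))
  where
  u = (m + n) C m
  v = (m + n) C suc m

-- The identity turning the source of the column weight into the transposed
-- source of the row weight:
--   C(n+2,2) C(N, n+1) = (m+1) C(N, m+1) + C(m+2,2) C(N, m+2),  N = m+n+1.
-- Doubled, both sides become multiples of C(m+n, m) and C(m+n, m+1), which
-- are related by `consecutive`.
column-source-identity : ∀ m n →
  (suc (suc n) C 2) * (suc (m + n) C suc n)
    ≡ suc m * (suc (m + n) C suc m) + (suc (suc m) C 2) * (suc (m + n) C suc (suc m))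
column-source-identity m n = *-cancelˡ-≡ _ _ 2 (begin
  2 * ((suc (suc n) C 2) * (suc M C suc n))
    ≡⟨ *-assoc 2 (suc (suc n) C 2) _ ⟨
  2 * (suc (suc n) C 2) * (suc M C suc n)
    ≡⟨ cong (_* (suc M C suc n)) (double-C2 n) ⟩
  suc (suc n) * suc n * (suc M C suc n)
    ≡⟨ *-assoc (suc (suc n)) (suc n) _ ⟩
  suc (suc n) * (suc n * (suc M C suc n))
    ≡⟨ cong (suc (suc n) *_) (trans (absorb M n) (cong (suc M *_) (C-symmetric m n))) ⟩
  suc (suc n) * (suc M * u)
    ≡⟨ split-n n (suc M) u ⟩
  suc M * (n * u) + 2 * (suc M * u)
    ≡⟨ cong (λ t → suc M * t + 2 * (suc M * u)) (consecutive m n) ⟩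
  suc M * (suc m * v) + 2 * (suc M * u)
    ≡⟨ cong (_+ 2 * (suc M * u)) (x∙yz≈y∙xz (suc M) (suc m) v) ⟩
  suc m * (suc M * v) + 2 * (suc M * u)
    ≡⟨ cong₂ (λ a b → suc m * a + 2 * b) (absorb M (suc m)) (absorb M m) ⟨
  suc m * (suc (suc m) * y) + 2 * (suc m * x)
    ≡⟨ cong (_+ 2 * (suc m * x)) (trans (x∙yz≈y∙xz (suc m) (suc (suc m)) y) (sym (*-assoc (suc (suc m)) (suc m) y))) ⟩
  suc (suc m) * suc m * y + 2 * (suc m * x)
    ≡⟨ cong (λ t → t * y + 2 * (suc m * x)) (double-C2 m) ⟨
  2 * (suc (suc m) C 2) * y + 2 * (suc m * x)
    ≡⟨ factor-2 (suc (suc m) C 2) y (suc m * x) ⟩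
  2 * (suc m * x + (suc (suc m) C 2) * y) ∎)
  where
  M = m + n
  u = M C m
  v = M C suc m
  x = suc M C suc m
  y = suc M C suc (suc m)
  split-n : ∀ n N u → suc (suc n) * (N * u) ≡ N * (n * u) + 2 * (N * u)
  split-n = solve-∀
  factor-2 : ∀ c y t → 2 * c * y + 2 * t ≡ 2 * (t + c * y)
  factor-2 = solve-∀

binomialSolution : (ℕ → ℕ) → ℕ → ℕ → ℕ
binomialSolution b m n = b m * ((m + n) C suc m)

binomial-pascal : ∀ (a b : ℕ → ℕ) → (∀ k → a (suc k) + b k ≡ b (suc k)) →
  Pascal (λ m n → a (suc m) * (suc (m + n) C suc m)) (binomialSolution b)
binomial-pascal a b step m n = begin
  b (suc m) * (suc N C suc (suc m))               ≡⟨ cong (b (suc m) *_) (pascal N (suc m)) ⟨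
  b (suc m) * (X + Y)                             ≡⟨ *-distribˡ-+ (b (suc m)) X Y ⟩
  b (suc m) * X + b (suc m) * Y                   ≡⟨ cong (λ t → t * X + b (suc m) * Y) (step m) ⟨
  (a (suc m) + b m) * X + b (suc m) * Y           ≡⟨ cong (_+ b (suc m) * Y) (*-distribʳ-+ X (a (suc m)) (b m)) ⟩
  a (suc m) * X + b m * X + b (suc m) * Y         ≡⟨ cong (_+ b (suc m) * Y) (+-comm (a (suc m) * X) (b m * X)) ⟩
  b m * X + a (suc m) * X + b (suc m) * Y
    ≡⟨ cong (λ t → b m * X + a (suc m) * (t C suc m) + b (suc m) * (t C suc (suc m))) (+-suc m n) ⟩
  binomialSolution b m (suc n) + a (suc m) * (suc (m + n) C suc m) + binomialSolution b (suc m) n ∎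
  where
  N = m + suc n
  X = N C suc m
  Y = N C suc (suc m)

binomial-vanishes : ∀ b → b 0 ≡ 0 → VanishesOnAxes (binomialSolution b)
binomial-vanishes b b0 =
  (λ n → cong (_* (n C 1)) b0) ,
  (λ m → trans (cong (λ t → b m * (t C suc m)) (+-identityʳ m)) (trans (cong (b m *_) (C-above m)) (*-zeroʳ (b m))))

rowWeight-total : ∀ (r b : ℕ → ℕ) → b 0 ≡ 0 → (∀ k → sum1 (suc k) r + b k ≡ b (suc k)) →
  ∀ m n → totalWeight (λ i _ → r i) m n ≡ binomialSolution b m n
rowWeight-total r b b0 step =
  pascal-unique (totalWeight-rec (λ i _ → r i)) (binomial-pascal (λ k → sum1 k r) b step)
                (totalWeight-vanishes (λ i _ → r i)) (binomial-vanishes b b0)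

unitWeight-total : ∀ m n → totalWeight (λ _ _ → 1) m n ≡ (suc m C 2) * ((m + n) C suc m)
unitWeight-total = rowWeight-total (λ _ → 1) (λ k → suc k C 2) refl
  (λ k → trans (cong (_+ suc k C 2) (trans (sum1-1 (suc k)) (sym (nC1≡n (suc k))))) (pascal (suc k) 1))

tetrahedral-step : ∀ k → sum1 (suc k) (λ i → i) + suc (suc k) C 3 ≡ suc (suc (suc k)) C 3
tetrahedral-step k = trans (cong (_+ suc (suc k) C 3) (triangular (suc k))) (pascal (suc (suc k)) 2)

rowIndex-total : ∀ m n → totalWeight (λ i _ → i) m n ≡ (suc (suc m) C 3) * ((m + n) C suc m)
rowIndex-total = rowWeight-total (λ i → i) (λ k → suc (suc k) C 3) refl tetrahedral-step

-- Weight j: shifting the column index by one adds the unit weight, so the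
-- source of the recurrence is the unit-weight total plus the first column.
columnIndex-pascal :
  Pascal (λ m n → sum1 (suc m) (λ _ → 1) * (suc (m + n) C suc m) + totalWeight (λ _ _ → 1) (suc m) n)
         (totalWeight (λ _ j → j))
columnIndex-pascal m n = begin
  T (suc m) (suc n)                                         ≡⟨ totalWeight-rec (λ _ j → j) m n ⟩
  T m (suc n) + s + totalWeight (λ _ j → 1 + j) (suc m) n   ≡⟨ cong (T m (suc n) + s +_)
                                                                   (totalWeight-+ (λ _ _ → 1) (λ _ j → j) (suc m) n) ⟩
  T m (suc n) + s + (K + T (suc m) n)                       ≡⟨ regroup (T m (suc n)) s K (T (suc m) n) ⟩
  T m (suc n) + (s + K) + T (suc m) n                       ∎
  where
  T = totalWeight (λ _ j → j)
  s = sum1 (suc m) (λ _ → 1) * (suc (m + n) C suc m)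
  K = totalWeight (λ _ _ → 1) (suc m) n
  regroup : ∀ a s k t → a + s + (k + t) ≡ a + (s + k) + t
  regroup = solve-∀

-- That source is the source of the weight i with m and n exchanged.
columnIndex-source : ∀ m n →
  sum1 (suc m) (λ _ → 1) * (suc (m + n) C suc m) + totalWeight (λ _ _ → 1) (suc m) n
    ≡ sum1 (suc n) (λ i → i) * (suc (n + m) C suc n)
columnIndex-source m n = begin
  sum1 (suc m) (λ _ → 1) * (suc (m + n) C suc m) + totalWeight (λ _ _ → 1) (suc m) n
    ≡⟨ cong₂ _+_ (cong (_* (suc (m + n) C suc m)) (sum1-1 (suc m))) (unitWeight-total (suc m) n) ⟩
  suc m * (suc (m + n) C suc m) + (suc (suc m) C 2) * (suc (m + n) C suc (suc m))
    ≡⟨ column-source-identity m n ⟨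
  (suc (suc n) C 2) * (suc (m + n) C suc n)
    ≡⟨ cong₂ (λ a t → a * (suc t C suc n)) (sym (triangular (suc n))) (+-comm m n) ⟩
  sum1 (suc n) (λ i → i) * (suc (n + m) C suc n) ∎

columnIndex-total : ∀ m n → totalWeight (λ _ j → j) m n ≡ (suc (suc n) C 3) * ((n + m) C suc n)
columnIndex-total =
  pascal-unique {T = totalWeight (λ _ j → j)} {F = flip (binomialSolution b)}
    (pascal-source {T = totalWeight (λ _ j → j)} columnIndex-source columnIndex-pascal)
    (pascal-flip {T = binomialSolution b} (binomial-pascal (λ k → sum1 k (λ i → i)) b tetrahedral-step))
    (totalWeight-vanishes (λ _ j → j)) (swap (binomial-vanishes b refl))
  where
  b : ℕ → ℕ
  b k = suc (suc k) C 3

lemma2p5 : (m n : ℕ) → 1 ≤ m → 1 ≤ n →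
    (sum1 m (λ i → sum1 n (λ j → i * f m n i j)) ≡ ((m + 2) C 3) * ((m + n) C (m + 1)))
    × (sum1 m (λ i → sum1 n (λ j → j * f m n i j)) ≡ ((n + 2) C 3) * ((m + n) C (n + 1)))
lemma2p5 m n _ _ = rowMoment , columnMoment
  where
  rowMoment : sum1 m (λ i → sum1 n (λ j → i * f m n i j)) ≡ ((m + 2) C 3) * ((m + n) C (m + 1))
  rowMoment = begin
    sum1 m (λ i → sum1 n (λ j → i * f m n i j))  ≡⟨ weighted-f-sum (λ i _ → i) m n ⟩
    totalWeight (λ i _ → i) m n                  ≡⟨ rowIndex-total m n ⟩
    (suc (suc m) C 3) * ((m + n) C suc m)        ≡⟨ cong₂ (λ a k → (a C 3) * ((m + n) C k)) (+-comm 2 m) (+-comm 1 m) ⟩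
    ((m + 2) C 3) * ((m + n) C (m + 1))          ∎
  columnMoment : sum1 m (λ i → sum1 n (λ j → j * f m n i j)) ≡ ((n + 2) C 3) * ((m + n) C (n + 1))
  columnMoment = begin
    sum1 m (λ i → sum1 n (λ j → j * f m n i j))  ≡⟨ weighted-f-sum (λ _ j → j) m n ⟩
    totalWeight (λ _ j → j) m n                  ≡⟨ columnIndex-total m n ⟩
    (suc (suc n) C 3) * ((n + m) C suc n)        ≡⟨ cong₂ (λ a b → (a C 3) * b) (+-comm 2 n) (cong₂ _C_ (+-comm n m) (+-comm 1 n)) ⟩
    ((n + 2) C 3) * ((m + n) C (n + 1))          ∎
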